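{- For every integer $k\ge1$, the vector $(1,3,k,1)$ is not realizable.
   Context: All graphs are finite, nonempty, simple and reflexive. Corner ranking: $N[v]$ is the closed neighborhood. In a graph $H$, $w$ strictly corners a distinct vertex $v$ if $N[v]\subsetneq N[w]$. Set $G^{(1)}=G$, $k=1$. If $G^{(k)}$ is a clique, give its vertices rank $k$ and stop; else if it has no strict corners, give its vertices rank $\infty$ and stop; else give all strict corners of $G^{(k)}$ rank $k$, delete them to get $G^{(k+1)}$, increase $k$, repeat. The corner rank $\alpha$ is the largest vertex rank; cop-win graphs are exactly those with finite corner rank. The rank cardinality vector of $G$ is $(x_\alpha,\ldots,x_1)$, $x_k$ being the number of vertices of rank $k$. A vector of positive integers is realizable if it is the rank cardinality vector of some cop-win graph. -}

module Defs where

open import Data.Nat using (ℕ; zero; suc; _⊔_)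
open import Data.Fin using (Fin)
open import Data.Bool using (Bool; true; false; T)
open import Data.List using (List; []; _∷_; length; filter; map; foldr; allFin)
open import Data.Product using (Σ; ∃; _×_; _,_)
open import Relation.Nullary using (¬_)
open import Relation.Binary.PropositionalEquality using (_≡_; _≢_)
open import Data.Nat using (_≟_)
open import Data.Unit using (⊤)

-- A finite, nonempty, simple, reflexive graph on the vertex set Fin n
-- (nonemptiness is imposed separately by taking n = suc m).
-- The adjacency relation includes loops (reflexive), so the closed
-- neighbourhood N[v] is exactly {u | adj v u}.
record Graph (n : ℕ) : Set where
  field
    adj  : Fin n → Fin n → Bool
    refl : ∀ v → adj v v ≡ true
    sym  : ∀ u v → adj u v ≡ adj v u
open Graph public

-- A vertex subset (the current induced subgraph G^(k)).
VSet : ℕ → Set₁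
VSet n = Fin n → Set

module _ {n : ℕ} (G : Graph n) where

  InN : VSet n → Fin n → Fin n → Set
  InN S v u = S u × T (adj G v u)

  NSub : VSet n → Fin n → Fin n → Set
  NSub S v w = ∀ u → InN S v u → InN S w u

  StrictlyCorners : VSet n → Fin n → Fin n → Set
  StrictlyCorners S w v = S w × S v × w ≢ v × NSub S v w × ¬ NSub S w v

  StrictCorner : VSet n → Fin n → Set
  StrictCorner S v = ∃ λ w → StrictlyCorners S w v

  IsClique : VSet n → Set
  IsClique S = ∀ u v → S u → S v → T (adj G u v)

  -- CornerRanking S k r : the corner ranking procedure, started at stage k
  -- with current graph G^(k) = induced subgraph on S, terminates with all
  -- ranks finite, assigning rank r v to each v ∈ S.
  data CornerRanking : VSet n → ℕ → (Fin n → ℕ) → Set₁ where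
    clique : ∀ {S k r} → IsClique S →
             (∀ v → S v → r v ≡ k) →
             CornerRanking S k r
    step   : ∀ {S S′ k r} → ¬ IsClique S →
             (∃ λ v → S v × StrictCorner S v) →
             (∀ v → S v → StrictCorner S v → r v ≡ k) →
             (∀ v → S′ v → S v × ¬ StrictCorner S v) →
             (∀ v → S v → ¬ StrictCorner S v → S′ v) →
             CornerRanking S′ (suc k) r →
             CornerRanking S k r

  Full : VSet n
  Full _ = ⊤

countRank : ∀ {n} → (Fin n → ℕ) → ℕ → ℕ
countRank {n} r i = length (filter (λ v → r v ≟ i) (allFin n))

cornerRank : ∀ {n} → (Fin n → ℕ) → ℕ
cornerRank {n} r = foldr _⊔_ 0 (map r (allFin n))

downFrom1 : ℕ → List ℕ
downFrom1 zero = []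
downFrom1 (suc m) = suc m ∷ downFrom1 m

rankCardinalityVector : ∀ {n} → (Fin n → ℕ) → List ℕ
rankCardinalityVector r = map (countRank r) (downFrom1 (cornerRank r))

-- A list of numbers is realizable if it is the rank cardinality vector of
-- some cop-win graph (i.e. one whose corner ranking terminates with finite
-- ranks), G = G^(1).
Realizable : List ℕ → Set₁
Realizable xs =
  ∃ λ m → Σ (Graph (suc m)) λ G → ∃ λ r →
    CornerRanking G (Full G) 1 r × rankCardinalityVector r ≡ xs

module Submission where

-- A corner ranking realising (1,3,k,1) has a unique rank-1 vertex v, so v is
-- the only strict corner of G; and G⁽³⁾ consists of four vertices: the three
-- rank-3 vertices, which are strict corners of G⁽³⁾, and the rank-4 vertex z,
-- which is not.  Two facts rule this out.
--  • 'FirstRounds': if v is the only strict corner of G, dominated by w, then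
--    G⁽³⁾ has an 'Anchor' (w itself, or a vertex of G⁽³⁾ dominating w in
--    G⁽²⁾).  This uses that every strict corner of G⁽²⁾ is adjacent to v and
--    that following strict dominators terminates ('Descent').
--  • 'no-bad-quadruple': no graph on four vertices has three strict corners,
--    a fourth vertex that is not one, and an anchor — checked by evaluation
--    on all 64 such graphs and carried to G⁽³⁾ along 'InducedCopy'.

open import Defs
open import Data.Nat using (ℕ; zero; suc; _≤_; _<_; _≥_; _⊔_; s≤s; z≤n; _≤?_; _<?_)
import Data.Nat as ℕ
open import Data.Nat.Properties
  using (≤-trans; ≤-reflexive; <-irrefl; <⇒≱; <ᵇ⇒<; m≤m⊔n; m≤n⊔m; n≤1+n; m≤n⇒m≤1+n; m<n⇒m<1+n)
open import Data.Nat.Induction using (<-wellFounded)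
open import Data.Fin using (Fin; zero; suc) renaming (_≟_ to _≟ᶠ_)
open import Data.Fin.Properties using (any?; all?)
open import Data.Bool using (Bool; true; false; T; _∧_)
open import Data.Bool.Properties using (T-∧)
open import Data.Vec using (Vec; []; _∷_)
open import Data.List using (List; []; _∷_; length; map; foldr; filter; allFin; lookup)
open import Data.List.Properties using (length-map)
open import Data.List.Membership.Propositional using (_∈_)
open import Data.List.Membership.Propositional.Properties using (∈-allFin; ∈-filter⁺; ∈-filter⁻; ∈-map⁺; ∈-lookup)
open import Data.List.Relation.Unary.Any using (here; there; index)
open import Data.List.Relation.Unary.Any.Properties using (lookup-index)
import Data.List.Relation.Unary.All as All
open import Data.List.Relation.Unary.AllPairs using (_∷_)
open import Data.List.Relation.Unary.Unique.Propositional using (Unique)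
open import Data.List.Relation.Unary.Unique.Propositional.Properties using (allFin⁺; filter⁺)
open import Data.Product using (∃; _×_; _,_; proj₁; proj₂)
open import Data.Sum using (_⊎_; inj₁; inj₂)
open import Data.Empty using (⊥; ⊥-elim)
open import Data.Unit using (tt)
open import Function using (id; _on_)
open import Function.Bundles using (Equivalence)
open import Induction.WellFounded using (Acc; acc)
import Relation.Binary.Construct.On as On
open import Relation.Nullary using (¬_; Dec; yes; no)
open import Relation.Nullary.Decidable using (T?; ¬?; _×-dec_; _→-dec_; map′; decidable-stable; toWitnessFalse; isNo)
open import Relation.Binary.PropositionalEquality as ≡ using (_≡_; _≢_; cong; subst)
open ≡.≡-Reasoning

pattern 𝟘 = zero
pattern 𝟙 = suc zero
pattern 𝟚 = suc (suc zero)
pattern 𝟛 = suc (suc (suc zero))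

module _ {n} (G : Graph n) where

  adj-sym : ∀ {x y} → T (adj G x y) → T (adj G y x)
  adj-sym {x} {y} = subst T (Graph.sym G x y)

  adj-refl : ∀ x → T (adj G x x)
  adj-refl x = subst T (≡.sym (Graph.refl G x)) tt

  Anchor : VSet n → Fin n → Set
  Anchor S t = ∀ x s → StrictlyCorners G S s x →
    ¬ ¬ (∃ λ y → S y × T (adj G y x) × T (adj G y t) × y ≢ s × t ≢ s)

  record Prunes (S S′ : VSet n) : Set where
    field
      kept-sound    : ∀ v → S′ v → S v × ¬ StrictCorner G S v
      kept-complete : ∀ v → S v → ¬ StrictCorner G S v → S′ v

  rank-≥-stage : ∀ {S k r x} → CornerRanking G S k r → S x → k ≤ r x
  rank-≥-stage {x = x} (clique _ ranked) Sx = ≤-reflexive (≡.sym (ranked x Sx))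
  rank-≥-stage {k = k} {r} {x} (step _ _ ranked _ kept rest) Sx =
    decidable-stable (k ≤? r x) λ k≰rx →
      let x-kept = kept x Sx λ corner → k≰rx (≤-reflexive (≡.sym (ranked x Sx corner)))
      in k≰rx (≤-trans (n≤1+n k) (rank-≥-stage rest x-kept))

  record Round (S : VSet n) (k : ℕ) (r : Fin n → ℕ) : Set₁ where
    field
      {next}        : VSet n
      prunes        : Prunes S next
      corner-ranked : ∀ v → S v → StrictCorner G S v → r v ≡ k
      rest          : CornerRanking G next (suc k) r
    open Prunes prunes public

    survivor-rank : ∀ {x} → next x → k < r x
    survivor-rank = rank-≥-stage rest

    survives : ∀ {x} → S x → r x ≢ k → next x
    survives {x} Sx rx≢k = kept-complete x Sx λ corner → rx≢k (corner-ranked x Sx corner)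

    ranked-here-is-corner : ∀ {x} → S x → r x ≡ k → ¬ ¬ StrictCorner G S x
    ranked-here-is-corner {x} Sx rx≡k not-corner =
      <-irrefl (≡.sym rx≡k) (survivor-rank (kept-complete x Sx not-corner))

  round : ∀ {S k r z} → CornerRanking G S k r → S z → r z ≢ k → Round S k r
  round {z = z} (clique _ ranked) Sz rz≢k = ⊥-elim (rz≢k (ranked z Sz))
  round (step _ _ ranked sound complete rest) _ _ = record
    { prunes = record { kept-sound = sound ; kept-complete = complete }
    ; corner-ranked = ranked
    ; rest = rest
    }

≤-maximum : ∀ {xs : List ℕ} {x} → x ∈ xs → x ≤ foldr _⊔_ 0 xs
≤-maximum {y ∷ _} (here ≡.refl) = m≤m⊔n y _
≤-maximum {y ∷ _} (there x∈xs) = ≤-trans (≤-maximum x∈xs) (m≤n⊔m y _)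

rank-≤-cornerRank : ∀ {n} (r : Fin n → ℕ) y → r y ≤ cornerRank r
rank-≤-cornerRank r y = ≤-maximum (∈-map⁺ r (∈-allFin y))

length-downFrom1 : ∀ m → length (downFrom1 m) ≡ m
length-downFrom1 zero = ≡.refl
length-downFrom1 (suc m) = cong suc (length-downFrom1 m)

entries⁴ : ∀ {a b c d a′ b′ c′ d′ : ℕ} → _≡_ {A = List ℕ} (a ∷ b ∷ c ∷ d ∷ []) (a′ ∷ b′ ∷ c′ ∷ d′ ∷ []) →
  a ≡ a′ × b ≡ b′ × c ≡ c′ × d ≡ d′
entries⁴ ≡.refl = ≡.refl , ≡.refl , ≡.refl , ≡.refl

profile : ∀ {n} (r : Fin n → ℕ) {k} → rankCardinalityVector r ≡ 1 ∷ 3 ∷ k ∷ 1 ∷ [] →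
  cornerRank r ≡ 4 × countRank r 4 ≡ 1 × countRank r 3 ≡ 3 × countRank r 1 ≡ 1
profile r {k} vec = let x₄ , x₃ , _ , x₁ = entries⁴ vec₄ in α≡4 , x₄ , x₃ , x₁
  where
  α≡4 : cornerRank r ≡ 4
  α≡4 = begin
    cornerRank r                       ≡⟨ ≡.sym (length-downFrom1 (cornerRank r)) ⟩
    length (downFrom1 (cornerRank r))  ≡⟨ ≡.sym (length-map (countRank r) (downFrom1 (cornerRank r))) ⟩
    length (rankCardinalityVector r)   ≡⟨ cong length vec ⟩
    4                                  ∎
  vec₄ : countRank r 4 ∷ countRank r 3 ∷ countRank r 2 ∷ countRank r 1 ∷ [] ≡ 1 ∷ 3 ∷ k ∷ 1 ∷ []
  vec₄ = subst (λ α → map (countRank r) (downFrom1 α) ≡ 1 ∷ 3 ∷ k ∷ 1 ∷ []) α≡4 vec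

lookup-injective : ∀ {A : Set} {xs : List A} → Unique xs → ∀ i j → lookup xs i ≡ lookup xs j → i ≡ j
lookup-injective {xs = _ ∷ _} _ zero zero _ = ≡.refl
lookup-injective {xs = _ ∷ _} (x∉ ∷ _) zero (suc j) e = ⊥-elim (All.lookup x∉ (∈-lookup j) e)
lookup-injective {xs = _ ∷ _} (x∉ ∷ _) (suc i) zero e = ⊥-elim (All.lookup x∉ (∈-lookup i) (≡.sym e))
lookup-injective {xs = _ ∷ _} (_ ∷ unique) (suc i) (suc j) e = cong suc (lookup-injective unique i j e)

module _ {n} (r : Fin n → ℕ) (i : ℕ) where

  record Enumeration (m : ℕ) : Set where
    field
      vertex   : Fin m → Fin n
      ranked   : ∀ j → r (vertex j) ≡ i
      distinct : ∀ j k → vertex j ≡ vertex k → j ≡ k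
      covers   : ∀ y → r y ≡ i → ∃ λ j → y ≡ vertex j

  enumerate : ∀ m → countRank r i ≡ m → Enumeration m
  enumerate m count≡m = subst Enumeration count≡m record
    { vertex   = lookup ofRank
    ; ranked   = λ j → proj₂ (∈-filter⁻ hasRank? {xs = allFin n} (∈-lookup j))
    ; distinct = lookup-injective (filter⁺ hasRank? (allFin⁺ n))
    ; covers   = λ y ry → let y∈ = ∈-filter⁺ hasRank? (∈-allFin y) ry in index y∈ , lookup-index y∈
    }
    where
    hasRank? : ∀ v → Dec (r v ≡ i)
    hasRank? v = r v ℕ.≟ i
    ofRank : List (Fin n)
    ofRank = filter hasRank? (allFin n)

sole-vertex : ∀ {n} {r : Fin n → ℕ} {i} (E : Enumeration r i 1) → ∀ y → r y ≡ i → y ≡ Enumeration.vertex E 𝟘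
sole-vertex E y ry with Enumeration.covers E y ry
... | 𝟘 , y≡ = y≡

module _ {A : Set} {P Q : A → Set} (P? : ∀ x → Dec (P x)) (Q? : ∀ x → Dec (Q x))
         (P⊆Q : ∀ {x} → P x → Q x) where

  filter-mono : ∀ xs → length (filter P? xs) ≤ length (filter Q? xs)
  filter-mono [] = z≤n
  filter-mono (x ∷ xs) with P? x | Q? x
  ... | yes _  | yes _  = s≤s (filter-mono xs)
  ... | yes px | no ¬qx = ⊥-elim (¬qx (P⊆Q px))
  ... | no _   | yes _  = m≤n⇒m≤1+n (filter-mono xs)
  ... | no _   | no _   = filter-mono xs

  filter-strict : ∀ {x xs} → x ∈ xs → Q x → ¬ P x → length (filter P? xs) < length (filter Q? xs)
  filter-strict {xs = y ∷ ys} x∈ qx ¬px with P? y | Q? y | x∈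
  ... | yes py | no ¬qy | _       = ⊥-elim (¬qy (P⊆Q py))
  ... | yes py | yes _  | here ≡.refl = ⊥-elim (¬px py)
  ... | yes _  | yes _  | there x∈ys = s≤s (filter-strict x∈ys qx ¬px)
  ... | no _   | yes _  | here ≡.refl = s≤s (filter-mono ys)
  ... | no _   | yes _  | there x∈ys = m<n⇒m<1+n (filter-strict x∈ys qx ¬px)
  ... | no _   | no ¬qy | here ≡.refl = ⊥-elim (¬qy qx)
  ... | no _   | no _   | there x∈ys = filter-strict x∈ys qx ¬px

module Descent {n} (G : Graph n) {S : VSet n} (S? : ∀ v → Dec (S v)) where

  Outside : Fin n → Fin n → Set
  Outside y t = S t × ¬ T (adj G y t)

  outside? : ∀ y t → Dec (Outside y t)
  outside? y t = S? t ×-dec ¬? (T? (adj G y t))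

  nonNeighbours : Fin n → ℕ
  nonNeighbours y = length (filter (outside? y) (allFin n))

  dominator-closer : ∀ {y₁ y₀} → StrictlyCorners G S y₁ y₀ → nonNeighbours y₁ < nonNeighbours y₀
  dominator-closer {y₁} {y₀} (_ , _ , _ , y₀⊆y₁ , y₁⊈y₀) =
    decidable-stable (nonNeighbours y₁ <? nonNeighbours y₀) λ ¬closer →
      y₁⊈y₀ λ t (St , y₁t) → St , decidable-stable (T? (adj G y₀ t)) λ ¬y₀t →
        ¬closer (filter-strict (outside? y₁) (outside? y₀) fewer (∈-allFin t) (St , ¬y₀t) λ (_ , ¬y₁t) → ¬y₁t y₁t)
    where
    fewer : ∀ {t} → Outside y₁ t → Outside y₀ t
    fewer {t} (St , ¬y₁t) = St , λ y₀t → ¬y₁t (proj₂ (y₀⊆y₁ t (St , y₀t)))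

  -- Following strict dominators upwards from y₀ stops at a vertex that is
  -- not a strict corner of S; it still dominates everything y₀ dominates.
  dominated-by-non-corner : ∀ {u y₀} → S y₀ → NSub G S u y₀ →
    ¬ ¬ (∃ λ y → S y × ¬ StrictCorner G S y × NSub G S u y)
  dominated-by-non-corner {u} {y₀} Sy₀ u⊆y₀ none =
    climb y₀ (On.wellFounded nonNeighbours <-wellFounded y₀) Sy₀ u⊆y₀
    where
    climb : ∀ y → Acc (_<_ on nonNeighbours) y → S y → NSub G S u y → ⊥
    climb y (acc above) Sy u⊆y = none (y , Sy , not-corner , u⊆y)
      where
      not-corner : ¬ StrictCorner G S y
      not-corner (y′ , y′▷y@(Sy′ , _ , _ , y⊆y′ , _)) =
        climb y′ (above (dominator-closer y′▷y)) Sy′ λ t t∈ → y⊆y′ t (u⊆y t t∈)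

-- The first two rounds of the procedure on a graph G whose only strict
-- corner is v, strictly cornered by w; S₂ = G⁽²⁾ and S₃ = G⁽³⁾.
module FirstRounds {n} (G : Graph n) {v w : Fin n}
  (w▷v : StrictlyCorners G (Full G) w v)
  (only-v : ∀ x → StrictCorner G (Full G) x → x ≡ v)
  {S₂ S₃ : VSet n} (round₁ : Prunes G (Full G) S₂) (round₂ : Prunes G S₂ S₃) where

  open Prunes

  S₂⁺ : ∀ {x} → x ≢ v → S₂ x
  S₂⁺ {x} x≢v = kept-complete round₁ x tt λ corner → x≢v (only-v x corner)

  S₂⁻ : ∀ {x} → S₂ x → x ≢ v
  S₂⁻ S₂v ≡.refl = proj₂ (kept-sound round₁ _ S₂v) (w , w▷v)

  S₂? : ∀ x → Dec (S₂ x)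
  S₂? x = map′ S₂⁺ S₂⁻ (¬? (x ≟ᶠ v))

  S₃⊆S₂ : ∀ {x} → S₃ x → S₂ x
  S₃⊆S₂ {x} S₃x = proj₁ (kept-sound round₂ x S₃x)

  corner-in-S₂ : ∀ {u} → StrictCorner G S₂ u → S₂ u
  corner-in-S₂ (_ , _ , S₂u , _) = S₂u

  lift-domination : ∀ {u y} → StrictlyCorners G S₂ y u → (T (adj G u v) → T (adj G y v)) →
    StrictlyCorners G (Full G) y u
  lift-domination {u} {y} (_ , _ , y≢u , u⊆y , y⊈u) inherit =
    tt , tt , y≢u , u⊆y-in-G , λ y⊆u → y⊈u λ t (S₂t , yt) → S₂t , proj₂ (y⊆u t (tt , yt))
    where
    u⊆y-in-G : NSub G (Full G) u y
    u⊆y-in-G t (_ , ut) with t ≟ᶠ v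
    ... | yes ≡.refl = tt , inherit ut
    ... | no t≢v = tt , proj₂ (u⊆y t (S₂⁺ t≢v , ut))

  -- Every strict corner of G⁽²⁾ is adjacent to v; otherwise it would also be
  -- a strict corner of G, i.e. equal to v.
  corner-adjacent-v : ∀ {u} → StrictCorner G S₂ u → T (adj G v u)
  corner-adjacent-v {u} u-corner@(y , y▷u) = decidable-stable (T? (adj G v u)) λ ¬vu →
    S₂⁻ (corner-in-S₂ u-corner) (only-v u (y , lift-domination y▷u λ uv → ⊥-elim (¬vu (adj-sym G uv))))

  Dominating : Fin n → Set
  Dominating t = ∀ u → StrictCorner G S₂ u → T (adj G t u)

  -- N[v] ⊆ N[w], so w inherits the adjacencies of v
  w-dominating : Dominating w
  w-dominating u u-corner = proj₂ (v⊆w u (tt , corner-adjacent-v u-corner))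
    where
    v⊆w : NSub G (Full G) v w
    v⊆w = proj₁ (proj₂ (proj₂ (proj₂ w▷v)))

  dominated-in-S₃ : ∀ {u} → StrictCorner G S₂ u → ¬ ¬ (∃ λ y → S₃ y × NSub G S₂ u y)
  dominated-in-S₃ (y₀ , S₂y₀ , _ , _ , u⊆y₀ , _) found =
    Descent.dominated-by-non-corner G S₂? S₂y₀ u⊆y₀ λ (y , S₂y , not-corner , u⊆y) →
      found (y , kept-complete round₂ y S₂y not-corner , u⊆y)

  -- If s strictly corners x in G⁽³⁾, some strict corner of G⁽²⁾ is adjacent
  -- to x but not to s; otherwise s would strictly corner x in G⁽²⁾ already.
  separating-corner : ∀ {x s} → StrictlyCorners G S₃ s x →
    ¬ ¬ (∃ λ u → StrictCorner G S₂ u × T (adj G u x) × ¬ T (adj G u s))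
  separating-corner {x} {s} (S₃s , S₃x , s≢x , x⊆s , s⊈x) none =
    proj₂ (kept-sound round₂ x S₃x) (s , S₃⊆S₂ S₃s , S₃⊆S₂ S₃x , s≢x , x⊆s-in-S₂ , s⊈x-in-S₂)
    where
    x⊆s-in-S₂ : NSub G S₂ x s
    x⊆s-in-S₂ t (S₂t , xt) = S₂t , decidable-stable (T? (adj G s t)) λ ¬st →
      let t-not-corner : ¬ StrictCorner G S₂ t
          t-not-corner t-corner = none (t , t-corner , adj-sym G xt , λ ts → ¬st (adj-sym G ts))
      in ¬st (proj₂ (x⊆s t (kept-complete round₂ t S₂t t-not-corner , xt)))
    s⊈x-in-S₂ : ¬ NSub G S₂ s x
    s⊈x-in-S₂ s⊆x = s⊈x λ t (S₃t , st) → S₃t , proj₂ (s⊆x t (S₃⊆S₂ S₃t , st))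

  -- A vertex of G⁽³⁾ adjacent to all strict corners of G⁽²⁾ is an anchor of
  -- G⁽³⁾: the common neighbour is a dominator of a separating corner.
  dominating-anchor : ∀ {t} → S₃ t → Dominating t → Anchor G S₃ t
  dominating-anchor {t} S₃t t-dom x s s▷x@(_ , S₃x , _) none =
    separating-corner s▷x λ (u , u-corner , ux , ¬us) →
    dominated-in-S₃ u-corner λ (y , S₃y , u⊆y) →
    let neighbour-of-y : ∀ {q} → S₂ q → T (adj G u q) → T (adj G y q)
        neighbour-of-y S₂q uq = proj₂ (u⊆y _ (S₂q , uq))
        ¬su : ∀ {q} → T (adj G q u) → q ≢ s
        ¬su qu q≡s = ¬us (adj-sym G (subst (λ p → T (adj G p u)) q≡s qu))
    in none ( y , S₃y
            , neighbour-of-y (S₃⊆S₂ S₃x) ux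
            , neighbour-of-y (S₃⊆S₂ S₃t) (adj-sym G (t-dom u u-corner))
            , ¬su (neighbour-of-y (corner-in-S₂ u-corner) (adj-refl G u))
            , ¬su (t-dom u u-corner) )

  -- G⁽³⁾ has an anchor: w, which survives to G⁽³⁾ because a dominator of w
  -- in G⁽³⁾ would itself be an anchor.
  anchor-exists : ¬ ¬ (∃ λ t → S₃ t × Anchor G S₃ t)
  anchor-exists none = anchor-at S₃w w-dominating
    where
    anchor-at : ∀ {y} → S₃ y → Dominating y → ⊥
    anchor-at S₃y y-dom = none (_ , S₃y , dominating-anchor S₃y y-dom)
    w-not-corner : ¬ StrictCorner G S₂ w
    w-not-corner w-corner = dominated-in-S₃ w-corner λ (y , S₃y , w⊆y) →
      anchor-at S₃y λ u u-corner → proj₂ (w⊆y u (corner-in-S₂ u-corner , w-dominating u u-corner))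
    S₃w : S₃ w
    S₃w = kept-complete round₂ w (S₂⁺ (proj₁ (proj₂ (proj₂ w▷v)))) w-not-corner

module Decide {n} (H : Graph n) where

  nsub? : ∀ v w → Dec (NSub H (Full H) v w)
  nsub? v w = all? λ u → (yes tt ×-dec T? (adj H v u)) →-dec (yes tt ×-dec T? (adj H w u))

  strictlyCorners? : ∀ w v → Dec (StrictlyCorners H (Full H) w v)
  strictlyCorners? w v = yes tt ×-dec yes tt ×-dec ¬? (w ≟ᶠ v) ×-dec nsub? v w ×-dec ¬? (nsub? w v)

  strictCorner? : ∀ v → Dec (StrictCorner H (Full H) v)
  strictCorner? v = any? λ w → strictlyCorners? w v

  anchor? : ∀ t → Dec (Anchor H (Full H) t)
  anchor? t = all? λ x → all? λ s → strictlyCorners? s x →-dec ¬? (¬? (any? λ y →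
    yes tt ×-dec T? (adj H y x) ×-dec T? (adj H y t) ×-dec ¬? (y ≟ᶠ s) ×-dec ¬? (t ≟ᶠ s)))

BadQuadruple : Graph 4 → Set
BadQuadruple H = ¬ StrictCorner H (Full H) 𝟘 × (∀ i → StrictCorner H (Full H) (suc i))
  × ∃ (Anchor H (Full H))

badQuadruple? : (H : Graph 4) → Dec (BadQuadruple H)
badQuadruple? H = ¬? (strictCorner? 𝟘) ×-dec all? (λ i → strictCorner? (suc i)) ×-dec any? anchor?
  where open Decide H

induced : ∀ {m n} → Graph n → (Fin m → Fin n) → Graph m
induced G f = record
  { adj  = λ i j → adj G (f i) (f j)
  ; refl = λ i → Graph.refl G (f i)
  ; sym  = λ i j → Graph.sym G (f i) (f j)
  }

record InducedCopy {m n} (K : Graph m) (G : Graph n) (S : VSet n) : Set where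
  field
    idx      : Fin m → Fin n
    idx-in   : ∀ i → S (idx i)
    idx-onto : ∀ y → S y → ∃ λ i → y ≡ idx i
    idx-inj  : ∀ i j → idx i ≡ idx j → i ≡ j
    idx-adj  : ∀ i j → adj K i j ≡ adj G (idx i) (idx j)

module Transfer {m n} {K : Graph m} {G : Graph n} {S : VSet n} (copy : InducedCopy K G S) where
  open InducedCopy copy

  adj⁺ : ∀ {i j} → T (adj G (idx i) (idx j)) → T (adj K i j)
  adj⁺ {i} {j} = subst T (≡.sym (idx-adj i j))

  adj⁻ : ∀ {i j} → T (adj K i j) → T (adj G (idx i) (idx j))
  adj⁻ {i} {j} = subst T (idx-adj i j)

  nsub⁺ : ∀ {x s} → NSub G S (idx x) (idx s) → NSub K (Full K) x s
  nsub⁺ x⊆s u (_ , xu) = tt , adj⁺ (proj₂ (x⊆s (idx u) (idx-in u , adj⁻ xu)))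

  nsub⁻ : ∀ {x s} → NSub K (Full K) x s → NSub G S (idx x) (idx s)
  nsub⁻ x⊆s y (Sy , xy) with idx-onto y Sy
  ... | u , ≡.refl = Sy , adj⁻ (proj₂ (x⊆s u (tt , adj⁺ xy)))

  strictlyCorners⁺ : ∀ {s x} → StrictlyCorners G S (idx s) (idx x) → StrictlyCorners K (Full K) s x
  strictlyCorners⁺ (_ , _ , s≢x , x⊆s , s⊈x) =
    tt , tt , (λ s≡x → s≢x (cong idx s≡x)) , nsub⁺ x⊆s , λ s⊆x → s⊈x (nsub⁻ s⊆x)

  strictlyCorners⁻ : ∀ {s x} → StrictlyCorners K (Full K) s x → StrictlyCorners G S (idx s) (idx x)
  strictlyCorners⁻ {s} {x} (_ , _ , s≢x , x⊆s , s⊈x) =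
    idx-in s , idx-in x , (λ e → s≢x (idx-inj s x e)) , nsub⁻ x⊆s , λ s⊆x → s⊈x (nsub⁺ s⊆x)

  strictCorner⁺ : ∀ {x} → StrictCorner G S (idx x) → StrictCorner K (Full K) x
  strictCorner⁺ (s , s▷x@(Ss , _)) with idx-onto s Ss
  ... | j , ≡.refl = j , strictlyCorners⁺ s▷x

  strictCorner⁻ : ∀ {x} → StrictCorner K (Full K) x → StrictCorner G S (idx x)
  strictCorner⁻ (j , j▷x) = idx j , strictlyCorners⁻ j▷x

  anchor⁺ : ∀ {t} → Anchor G S (idx t) → Anchor K (Full K) t
  anchor⁺ {t} anchor x s s▷x none = anchor (idx x) (idx s) (strictlyCorners⁻ s▷x) λ (y , Sy , rest) →
    common-neighbour (idx-onto y Sy) rest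
    where
    common-neighbour : ∀ {y} → (∃ λ j → y ≡ idx j) →
      T (adj G y (idx x)) × T (adj G y (idx t)) × y ≢ idx s × idx t ≢ idx s → ⊥
    common-neighbour (j , ≡.refl) (yx , yt , y≢s , t≢s) =
      none (j , tt , adj⁺ yx , adj⁺ yt , (λ j≡s → y≢s (cong idx j≡s)) , λ t≡s → t≢s (cong idx t≡s))

-- The bad configuration in an induced subgraph on four vertices carries over
-- to the copy, where it is decidable and can therefore be recovered from
-- double negations.
bad-transfer : ∀ {n} {K : Graph 4} {G : Graph n} {S : VSet n} (copy : InducedCopy K G S) →
  let open InducedCopy copy in
  ¬ StrictCorner G S (idx 𝟘) → (∀ i → ¬ ¬ StrictCorner G S (idx (suc i))) →
  ¬ ¬ (∃ λ t → S t × Anchor G S t) → ¬ ¬ BadQuadruple K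
bad-transfer {K = K} {G} {S} copy zero-not-corner corners anchored bad =
  anchored λ (t , St , anchor) → anchor-at (idx-onto t St) anchor
  where
  open InducedCopy copy
  open Transfer copy
  open Decide K
  anchor-at : ∀ {t} → (∃ λ j → t ≡ idx j) → Anchor G S t → ⊥
  anchor-at (j , ≡.refl) anchor =
    bad ( (λ corner → zero-not-corner (strictCorner⁻ corner))
        , (λ i → decidable-stable (strictCorner? (suc i)) λ ¬corner → corners i λ corner → ¬corner (strictCorner⁺ corner))
        , j , anchor⁺ anchor )
edgeMatrix : Vec Bool 6 → Fin 4 → Fin 4 → Bool
edgeMatrix _                                    𝟘 𝟘 = true
edgeMatrix (e₀₁ ∷ _)                            𝟘 𝟙 = e₀₁
edgeMatrix (_ ∷ e₀₂ ∷ _)                        𝟘 𝟚 = e₀₂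
edgeMatrix (_ ∷ _ ∷ e₀₃ ∷ _)                    𝟘 𝟛 = e₀₃
edgeMatrix (e₀₁ ∷ _)                            𝟙 𝟘 = e₀₁
edgeMatrix _                                    𝟙 𝟙 = true
edgeMatrix (_ ∷ _ ∷ _ ∷ e₁₂ ∷ _)                𝟙 𝟚 = e₁₂
edgeMatrix (_ ∷ _ ∷ _ ∷ _ ∷ e₁₃ ∷ _)            𝟙 𝟛 = e₁₃
edgeMatrix (_ ∷ e₀₂ ∷ _)                        𝟚 𝟘 = e₀₂
edgeMatrix (_ ∷ _ ∷ _ ∷ e₁₂ ∷ _)                𝟚 𝟙 = e₁₂
edgeMatrix _                                    𝟚 𝟚 = true
edgeMatrix (_ ∷ _ ∷ _ ∷ _ ∷ _ ∷ e₂₃ ∷ _)        𝟚 𝟛 = e₂₃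
edgeMatrix (_ ∷ _ ∷ e₀₃ ∷ _)                    𝟛 𝟘 = e₀₃
edgeMatrix (_ ∷ _ ∷ _ ∷ _ ∷ e₁₃ ∷ _)            𝟛 𝟙 = e₁₃
edgeMatrix (_ ∷ _ ∷ _ ∷ _ ∷ _ ∷ e₂₃ ∷ _)        𝟛 𝟚 = e₂₃
edgeMatrix _                                    𝟛 𝟛 = true

fromEdges : Vec Bool 6 → Graph 4
fromEdges (e₀₁ ∷ e₀₂ ∷ e₀₃ ∷ e₁₂ ∷ e₁₃ ∷ e₂₃ ∷ []) = record
  { adj  = edgeMatrix (e₀₁ ∷ e₀₂ ∷ e₀₃ ∷ e₁₂ ∷ e₁₃ ∷ e₂₃ ∷ [])
  ; refl = λ { 𝟘 → ≡.refl ; 𝟙 → ≡.refl ; 𝟚 → ≡.refl ; 𝟛 → ≡.refl }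
  ; sym  = λ { 𝟘 𝟘 → ≡.refl ; 𝟘 𝟙 → ≡.refl ; 𝟘 𝟚 → ≡.refl ; 𝟘 𝟛 → ≡.refl
             ; 𝟙 𝟘 → ≡.refl ; 𝟙 𝟙 → ≡.refl ; 𝟙 𝟚 → ≡.refl ; 𝟙 𝟛 → ≡.refl
             ; 𝟚 𝟘 → ≡.refl ; 𝟚 𝟙 → ≡.refl ; 𝟚 𝟚 → ≡.refl ; 𝟚 𝟛 → ≡.refl
             ; 𝟛 𝟘 → ≡.refl ; 𝟛 𝟙 → ≡.refl ; 𝟛 𝟚 → ≡.refl ; 𝟛 𝟛 → ≡.refl }
  }

asEdges : (H : Graph 4) → InducedCopy
  (fromEdges (adj H 𝟘 𝟙 ∷ adj H 𝟘 𝟚 ∷ adj H 𝟘 𝟛 ∷ adj H 𝟙 𝟚 ∷ adj H 𝟙 𝟛 ∷ adj H 𝟚 𝟛 ∷ [])) H (Full H)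
asEdges H = record
  { idx = id ; idx-in = λ _ → tt ; idx-onto = λ y _ → y , ≡.refl ; idx-inj = λ _ _ e → e
  ; idx-adj = λ
      { 𝟘 𝟘 → loop 𝟘 ; 𝟘 𝟙 → ≡.refl ; 𝟘 𝟚 → ≡.refl ; 𝟘 𝟛 → ≡.refl
      ; 𝟙 𝟘 → Graph.sym H 𝟘 𝟙 ; 𝟙 𝟙 → loop 𝟙 ; 𝟙 𝟚 → ≡.refl ; 𝟙 𝟛 → ≡.refl
      ; 𝟚 𝟘 → Graph.sym H 𝟘 𝟚 ; 𝟚 𝟙 → Graph.sym H 𝟙 𝟚 ; 𝟚 𝟚 → loop 𝟚 ; 𝟚 𝟛 → ≡.refl
      ; 𝟛 𝟘 → Graph.sym H 𝟘 𝟛 ; 𝟛 𝟙 → Graph.sym H 𝟙 𝟛 ; 𝟛 𝟚 → Graph.sym H 𝟚 𝟛 ; 𝟛 𝟛 → loop 𝟛 }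
  }
  where
  loop : ∀ i → true ≡ adj H i i
  loop i = ≡.sym (Graph.refl H i)

allVectors : ∀ k → (Vec Bool k → Bool) → Bool
allVectors zero    p = p []
allVectors (suc k) p = allVectors k (λ bs → p (true ∷ bs)) ∧ allVectors k (λ bs → p (false ∷ bs))

allVectors-sound : ∀ k p → T (allVectors k p) → ∀ bs → T (p bs)
allVectors-sound zero    p holds [] = holds
allVectors-sound (suc k) p holds (true ∷ bs) = allVectors-sound k _ (proj₁ (Equivalence.to T-∧ holds)) bs
allVectors-sound (suc k) p holds (false ∷ bs) = allVectors-sound k _ (proj₂ (Equivalence.to T-∧ holds)) bs

-- Exhaustive evaluation: none of the 64 graphs on four labelled vertices
-- has the bad configuration.
no-bad-fromEdges : ∀ es → ¬ BadQuadruple (fromEdges es)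
no-bad-fromEdges es = toWitnessFalse {a? = badQuadruple? (fromEdges es)} (allVectors-sound 6 noBad evaluated es)
  where
  noBad : Vec Bool 6 → Bool
  noBad es = isNo (badQuadruple? (fromEdges es))
  evaluated : T (allVectors 6 noBad)
  evaluated = tt

no-bad-quadruple : (H : Graph 4) → ¬ BadQuadruple H
no-bad-quadruple H (zero-not-corner , corners , t , anchor) =
  bad-transfer (asEdges H) zero-not-corner (λ i not-corner → not-corner (corners i))
    (λ none → none (t , tt , anchor)) (no-bad-fromEdges _)

three-or-four : ∀ {m} → 3 ≤ m → m ≤ 4 → m ≡ 3 ⊎ m ≡ 4
three-or-four {3} _ _ = inj₁ ≡.refl
three-or-four {4} _ _ = inj₂ ≡.refl
three-or-four {suc (suc (suc (suc (suc _))))} _ (s≤s (s≤s (s≤s (s≤s ()))))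
three-or-four {2} (s≤s (s≤s ())) _
three-or-four {1} (s≤s ()) _
three-or-four {0} () _

module NoRealization {n} (G : Graph n) (r : Fin n → ℕ) (ranking : CornerRanking G (Full G) 1 r)
  (α≡4 : cornerRank r ≡ 4) (x₄≡1 : countRank r 4 ≡ 1) (x₃≡3 : countRank r 3 ≡ 3) (x₁≡1 : countRank r 1 ≡ 1)
  where

  open Round

  rank-≢ : ∀ {x i j} → i ≤ r x → T (j ℕ.<ᵇ i) → r x ≢ j
  rank-≢ {i = i} {j} i≤rx j<i rx≡j = <⇒≱ (<ᵇ⇒< j i j<i) (subst (i ≤_) rx≡j i≤rx)

  bottom : Enumeration r 1 1
  bottom = enumerate r 1 1 x₁≡1

  top : Enumeration r 4 1
  top = enumerate r 4 1 x₄≡1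

  middle : Enumeration r 3 3
  middle = enumerate r 3 3 x₃≡3

  v z : Fin n
  v = Enumeration.vertex bottom 𝟘
  z = Enumeration.vertex top 𝟘

  z≥4 : 4 ≤ r z
  z≥4 = ≤-reflexive (≡.sym (Enumeration.ranked top 𝟘))

  -- since z has rank 4, stages 1, 2, 3 are deletion rounds
  round₁ : Round G (Full G) 1 r
  round₁ = round G ranking tt (rank-≢ z≥4 tt)

  round₂ : Round G (next round₁) 2 r
  round₂ = round G (rest round₁) (survives round₁ tt (rank-≢ z≥4 tt)) (rank-≢ z≥4 tt)

  S₃ : VSet n
  S₃ = next round₂

  in-S₃ : ∀ {x} → 3 ≤ r x → S₃ x
  in-S₃ 3≤rx = survives round₂ (survives round₁ tt (rank-≢ 3≤rx tt)) (rank-≢ 3≤rx tt)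

  quadruple : Fin 4 → Fin n
  quadruple 𝟘 = z
  quadruple (suc j) = Enumeration.vertex middle j

  quadruple-rank : ∀ {j} → r (quadruple (suc j)) ≡ 3
  quadruple-rank {j} = Enumeration.ranked middle j

  quadruple-in-S₃ : ∀ j → S₃ (quadruple j)
  quadruple-in-S₃ 𝟘 = in-S₃ (≤-trans (n≤1+n 3) z≥4)
  quadruple-in-S₃ (suc j) = in-S₃ (≤-reflexive (≡.sym quadruple-rank))

  round₃ : Round G S₃ 3 r
  round₃ = round G (rest round₂) (quadruple-in-S₃ 𝟘) (rank-≢ z≥4 tt)

  quadruple-onto : ∀ y → S₃ y → ∃ λ j → y ≡ quadruple j
  quadruple-onto y S₃y with three-or-four (survivor-rank round₂ S₃y) (subst (r y ≤_) α≡4 (rank-≤-cornerRank r y))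
  ... | inj₁ ry≡3 = let j , y≡ = Enumeration.covers middle y ry≡3 in suc j , y≡
  ... | inj₂ ry≡4 = 𝟘 , sole-vertex top y ry≡4

  quadruple-inj : ∀ i j → quadruple i ≡ quadruple j → i ≡ j
  quadruple-inj 𝟘 𝟘 _ = ≡.refl
  quadruple-inj 𝟘 (suc j) z≡ = ⊥-elim (rank-≢ (subst (λ y → 4 ≤ r y) z≡ z≥4) tt quadruple-rank)
  quadruple-inj (suc i) 𝟘 ≡z = ⊥-elim (rank-≢ (subst (λ y → 4 ≤ r y) (≡.sym ≡z) z≥4) tt quadruple-rank)
  quadruple-inj (suc i) (suc j) e = cong suc (Enumeration.distinct middle i j e)

  copy : InducedCopy (induced G quadruple) G S₃
  copy = record
    { idx      = quadruple
    ; idx-in   = quadruple-in-S₃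
    ; idx-onto = quadruple-onto
    ; idx-inj  = quadruple-inj
    ; idx-adj  = λ _ _ → ≡.refl
    }

  -- z is not a strict corner of G⁽³⁾, since it is not ranked 3
  z-not-corner : ¬ StrictCorner G S₃ z
  z-not-corner corner = rank-≢ z≥4 tt (corner-ranked round₃ z (quadruple-in-S₃ 𝟘) corner)

  rank-3-corners : ∀ j → ¬ ¬ StrictCorner G S₃ (quadruple (suc j))
  rank-3-corners j = ranked-here-is-corner round₃ (quadruple-in-S₃ (suc j)) quadruple-rank

  only-v : ∀ x → StrictCorner G (Full G) x → x ≡ v
  only-v x corner = sole-vertex bottom x (corner-ranked round₁ x tt corner)

  -- v is strictly cornered by some w, so G⁽³⁾ has an anchor
  anchored : ¬ ¬ (∃ λ t → S₃ t × Anchor G S₃ t)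
  anchored none = ranked-here-is-corner round₁ tt (Enumeration.ranked bottom 𝟘) λ (w , w▷v) →
    FirstRounds.anchor-exists G w▷v only-v (prunes round₁) (prunes round₂) none

  contradiction : ⊥
  contradiction = bad-transfer copy z-not-corner rank-3-corners anchored (no-bad-quadruple (induced G quadruple))

corollary3p25 : (k : ℕ) → k ≥ 1 → ¬ Realizable (1 ∷ 3 ∷ k ∷ 1 ∷ [])
corollary3p25 k _ (_ , G , r , ranking , vector) =
  let α≡4 , x₄≡1 , x₃≡3 , x₁≡1 = profile r vector
  in NoRealization.contradiction G r ranking α≡4 x₄≡1 x₃≡3 x₁≡1
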